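{- Let $F(X,Y),G(X,Y)\in\mathbb{Z}[X,Y]$ be homogeneous polynomials of degree $d$, and let $(x,y)\in\mathbb{Z}^2$ with $\gcd(x,y)=1$. Let $(x',y')\in\mathbb{Z}^2$ be any pair with $x'\equiv F(x,y) \pmod{\operatorname{Res}(F,G)}$ and $y'\equiv G(x,y)\pmod{\operatorname{Res}(F,G)}$. Then \[ \gcd(F(x,y),G(x,y)) = \gcd(x',y',\operatorname{Res}(F,G)). \]
   Context: $\operatorname{Res}(F,G)$ denotes the resultant of the homogeneous polynomials $F$ and $G$ (the determinant of their $2d\times 2d$ Sylvester matrix). -}

module Defs where

open import Data.Nat as ℕ using (ℕ; zero; suc; _∸_; _<?_; _≤?_)
open import Data.Integer using (ℤ; +_; _+_; _*_; -_; _^_; 0ℤ; 1ℤ)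
open import Data.Fin using (Fin; toℕ; punchIn)
import Data.Fin as Fin
open import Relation.Nullary.Decidable using (yes; no)

sumFin : (n : ℕ) → (Fin n → ℤ) → ℤ
sumFin zero    f = 0ℤ
sumFin (suc n) f = f Fin.zero + sumFin n (λ i → f (Fin.suc i))

-- A binary form of degree d over ℤ:
--   F(X,Y) = Σ_{i=0}^{d} a_i X^(d-i) Y^i ,  represented by (a_0,…,a_d).
-- (Any coefficients allowed, including zero: "homogeneous of degree d".)
Form : ℕ → Set
Form d = Fin (suc d) → ℤ

eval : (d : ℕ) → Form d → ℤ → ℤ → ℤ
eval d a x y = sumFin (suc d) (λ i → a i * ((x ^ (d ∸ toℕ i)) * (y ^ toℕ i)))

coef : (d : ℕ) → Form d → ℕ → ℤ
coef d a k with k ℕ.<? suc d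
... | yes k<d+1 = a (Fin.fromℕ< k<d+1)
... | no  _     = 0ℤ

det : (n : ℕ) → (Fin n → Fin n → ℤ) → ℤ
det zero    M = 1ℤ
det (suc n) M =
  sumFin (suc n) (λ j → ((- 1ℤ) ^ toℕ j) * (M Fin.zero j *
    det n (λ r c → M (Fin.suc r) (punchIn j c))))

band : (d : ℕ) → Form d → ℕ → ℕ → ℤ
band d a r c with r ℕ.≤? c
... | yes _ = coef d a (c ∸ r)
... | no  _ = 0ℤ

-- Sylvester matrix (2d × 2d) of two forms of degree d:
-- rows 0..d-1 are the shifted coefficients of F, rows d..2d-1 those of G.
sylvester : (d : ℕ) → Form d → Form d → Fin (d ℕ.+ d) → Fin (d ℕ.+ d) → ℤ
sylvester d a b r c with toℕ r ℕ.<? d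
... | yes _ = band d a (toℕ r) (toℕ c)
... | no  _ = band d b (toℕ r ∸ d) (toℕ c)

Res : (d : ℕ) → Form d → Form d → ℤ
Res d a b = det (d ℕ.+ d) (sylvester d a b)

module Submission where

-- Since every divisor of R divides x′ - F(x,y) and y′ - G(x,y), the two
-- triples have the same common divisors as soon as every common divisor g
-- of F(x,y) and G(x,y) divides R; that is the real content.  Let S be the
-- Sylvester matrix (size m+1, m = 2d-1) and w_j = x^(m-j)·y^j.  Each row of
-- S paired with w is a monomial times F(x,y) or G(x,y), hence divisible by
-- g.  A Horner sweep of adjacent-column operations turns the last column of
-- S into S·w while multiplying the determinant by a power of y; the mirror
-- sweep does the same for the first column with a power of x.  So g divides
-- x^N·R and y^N·R, and gcd(x,y) = 1 gives g ∣ R.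

open import Defs
open import Data.Nat as ℕ using (ℕ; zero; suc; z≤n; s≤s; _∸_; _<_; _≤_; _≥_)
import Data.Nat.Properties as ℕP
import Data.Nat.Divisibility as ℕ∣
open import Data.Nat.Coprimality using (Coprime; coprime-factors; gcd≡1⇒coprime)
import Data.Nat.Tactic.RingSolver as ℕSolver
open import Data.Integer using (ℤ; +_; _+_; _*_; -_; _-_; _^_; 0ℤ; 1ℤ; ∣_∣)
import Data.Integer.Properties as ℤP
open import Data.Integer.Divisibility using (_∣_)
open import Data.Integer.Divisibility.Signed as Signed using (divides; ∣m∣n⇒∣m+n; ∣n⇒∣m*n; ∣m⇒∣m*n)
  renaming (_∣_ to _∣ₛ_)
open import Data.Integer.GCD using (gcd; gcd[i,j]∣i; gcd[i,j]∣j; gcd-greatest)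
open import Data.Integer.Tactic.RingSolver using (solve-∀)
open import Data.Fin using (Fin; toℕ; punchIn)
import Data.Fin as Fin
import Data.Fin.Properties as FinP
open import Data.Product using (Σ; _×_; _,_)
open import Data.Sum using (_⊎_; inj₁; inj₂)
open import Data.Empty using (⊥-elim)
open import Relation.Nullary using (yes; no)
open import Relation.Binary.PropositionalEquality
open import Function using (_∘′_)

sumTo : ℕ → (ℕ → ℤ) → ℤ
sumTo n h = sumFin n (λ i → h (toℕ i))

sumFin-cong : ∀ n {f g : Fin n → ℤ} → (∀ i → f i ≡ g i) → sumFin n f ≡ sumFin n g
sumFin-cong zero    e = refl
sumFin-cong (suc n) e = cong₂ _+_ (e Fin.zero) (sumFin-cong n (λ i → e (Fin.suc i)))

sumTo-cong : ∀ n {f g : ℕ → ℤ} → (∀ i → i < n → f i ≡ g i) → sumTo n f ≡ sumTo n g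
sumTo-cong n e = sumFin-cong n (λ i → e (toℕ i) (FinP.toℕ<n i))

sumTo-zero : ∀ n {h : ℕ → ℤ} → (∀ i → i < n → h i ≡ 0ℤ) → sumTo n h ≡ 0ℤ
sumTo-zero zero    z = refl
sumTo-zero (suc n) z =
  cong₂ _+_ (z 0 (s≤s z≤n)) (sumTo-zero n (λ i i<n → z (suc i) (s≤s i<n)))

sumFin-linear : ∀ n a b (f g : Fin n → ℤ) →
  sumFin n (λ i → a * f i + b * g i) ≡ a * sumFin n f + b * sumFin n g
sumFin-linear zero    a b f g = zeros a b
  where
  zeros : ∀ a b → 0ℤ ≡ a * 0ℤ + b * 0ℤ
  zeros = solve-∀
sumFin-linear (suc n) a b f g =
  trans (cong (λ s → (a * f Fin.zero + b * g Fin.zero) + s)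
              (sumFin-linear n a b (λ i → f (Fin.suc i)) (λ i → g (Fin.suc i))))
        (regroup a b (f Fin.zero) (g Fin.zero) _ _)
  where
  regroup : ∀ a b f₀ g₀ F G → (a * f₀ + b * g₀) + (a * F + b * G) ≡ a * (f₀ + F) + b * (g₀ + G)
  regroup = solve-∀

sumFin-scale : ∀ n a (f : Fin n → ℤ) → sumFin n (λ i → a * f i) ≡ a * sumFin n f
sumFin-scale zero    a f = sym (ℤP.*-zeroʳ a)
sumFin-scale (suc n) a f =
  trans (cong (λ s → a * f Fin.zero + s) (sumFin-scale n a (λ i → f (Fin.suc i))))
        (sym (ℤP.*-distribˡ-+ a (f Fin.zero) _))

sumFin-divisible : ∀ n g {f : Fin n → ℤ} → (∀ i → g ∣ₛ f i) → g ∣ₛ sumFin n f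
sumFin-divisible zero    g h = divides 0ℤ refl
sumFin-divisible (suc n) g h = ∣m∣n⇒∣m+n (h Fin.zero) (sumFin-divisible n g (λ i → h (Fin.suc i)))

sumTo-snoc : ∀ n (h : ℕ → ℤ) → sumTo (suc n) h ≡ sumTo n h + h n
sumTo-snoc zero    h = trans (ℤP.+-identityʳ (h 0)) (sym (ℤP.+-identityˡ (h 0)))
sumTo-snoc (suc n) h = trans (cong (λ s → h 0 + s) (sumTo-snoc n (λ i → h (suc i))))
                             (sym (ℤP.+-assoc (h 0) _ _))

sumTo-reverse : ∀ n (h : ℕ → ℤ) → sumTo n h ≡ sumTo n (λ i → h (n ∸ suc i))
sumTo-reverse zero    h = refl
sumTo-reverse (suc n) h = begin
  h 0 + sumTo n (λ i → h (suc i))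
    ≡⟨ cong (λ s → h 0 + s) (sumTo-reverse n (λ i → h (suc i))) ⟩
  h 0 + sumTo n (λ i → h (suc (n ∸ suc i)))
    ≡⟨ cong (λ s → h 0 + s) (sumTo-cong n (λ i i<n → cong h (sym (ℕP.+-∸-assoc 1 i<n)))) ⟩
  h 0 + sumTo n (λ i → h (n ∸ i))
    ≡⟨ ℤP.+-comm (h 0) _ ⟩
  sumTo n (λ i → h (n ∸ i)) + h 0
    ≡⟨ cong (λ e → sumTo n (λ i → h (n ∸ i)) + h e) (sym (ℕP.n∸n≡0 n)) ⟩
  sumTo n (λ i → h (n ∸ i)) + h (n ∸ n)
    ≡⟨ sym (sumTo-snoc n (λ i → h (n ∸ i))) ⟩
  sumTo (suc n) (λ i → h (n ∸ i)) ∎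
  where open ≡-Reasoning

sumTo-cancel : ∀ n k (h : ℕ → ℤ) → suc k < n →
  (∀ i → i < n → i ≢ k → i ≢ suc k → h i ≡ 0ℤ) → h (suc k) ≡ - h k → sumTo n h ≡ 0ℤ
sumTo-cancel (suc (suc n)) zero h _ z opp = begin
  h 0 + (h 1 + sumTo n (λ i → h (suc (suc i))))
    ≡⟨ cong₂ (λ u v → h 0 + (u + v)) opp
             (sumTo-zero n (λ i i<n → z (suc (suc i)) (s≤s (s≤s i<n)) (λ ()) (λ ()))) ⟩
  h 0 + (- h 0 + 0ℤ)
    ≡⟨ cong (λ s → h 0 + s) (ℤP.+-identityʳ (- h 0)) ⟩
  h 0 + - h 0
    ≡⟨ ℤP.+-inverseʳ (h 0) ⟩
  0ℤ ∎
  where open ≡-Reasoning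
sumTo-cancel (suc n) (suc k) h (s≤s k<n) z opp =
  trans (cong₂ _+_ (z 0 (s≤s z≤n) (λ ()) (λ ()))
                   (sumTo-cancel n k (λ i → h (suc i)) k<n
                      (λ i i<n i≢k i≢sk → z (suc i) (s≤s i<n) (i≢k ∘′ ℕP.suc-injective)
                                                              (i≢sk ∘′ ℕP.suc-injective))
                      opp))
        (ℤP.+-identityˡ 0ℤ)

-- Matrices indexed by ℕ; only the top-left n×n block matters for det′ n.
Matrix : Set
Matrix = ℕ → ℕ → ℤ

-- punch j c is the column of the full matrix that becomes column c of the
-- minor in which column j is deleted (Data.Fin.punchIn, on ℕ).
punch : ℕ → ℕ → ℕ
punch zero    c       = suc c
punch (suc j) zero    = zero
punch (suc j) (suc c) = suc (punch j c)

toℕ-punchIn : ∀ {n} (j : Fin (suc n)) (c : Fin n) → toℕ (punchIn j c) ≡ punch (toℕ j) (toℕ c)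
toℕ-punchIn Fin.zero    c           = refl
toℕ-punchIn (Fin.suc j) Fin.zero    = refl
toℕ-punchIn (Fin.suc j) (Fin.suc c) = cong suc (toℕ-punchIn j c)

punch≢ : ∀ j c → punch j c ≢ j
punch≢ (suc j) (suc c) e = punch≢ j c (ℕP.suc-injective e)

punch-injective : ∀ j c c′ → punch j c ≡ punch j c′ → c ≡ c′
punch-injective zero    c       c′       e = ℕP.suc-injective e
punch-injective (suc j) zero    zero     e = refl
punch-injective (suc j) (suc c) (suc c′) e = cong suc (punch-injective j c c′ (ℕP.suc-injective e))

punch-< : ∀ {n} j c → c < n → punch j c < suc n
punch-< zero    c       c<n       = s≤s c<n
punch-< (suc j) zero    c<n       = s≤s z≤n
punch-< (suc j) (suc c) (s≤s c<n) = s≤s (punch-< j c c<n)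

punch-surjective : ∀ n j k → j ≢ k → j < suc n → k < suc n → Σ ℕ λ k′ → punch j k′ ≡ k × k′ < n
punch-surjective n       zero    zero    j≢k _ _ = ⊥-elim (j≢k refl)
punch-surjective n       zero    (suc k) _   _ (s≤s k<n) = k , refl , k<n
punch-surjective (suc n) (suc j) zero    _   _ _ = 0 , refl , s≤s z≤n
punch-surjective (suc n) (suc j) (suc k) j≢k (s≤s j<n) (s≤s k<n)
  with punch-surjective n j k (j≢k ∘′ cong suc) j<n k<n
... | k′ , e , k′<n = suc k′ , cong suc e , s≤s k′<n
punch-surjective zero    (suc j) k       _   (s≤s ()) _

punch-suc : ∀ j c → j ≢ suc (punch j c) → punch j (suc c) ≡ suc (punch j c)
punch-suc zero          c       _   = refl
punch-suc (suc zero)    zero    j≢  = ⊥-elim (j≢ refl)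
punch-suc (suc (suc j)) zero    _   = refl
punch-suc (suc j)       (suc c) j≢  = cong suc (punch-suc j c (j≢ ∘′ cong suc))

punch-neighbours : ∀ k c → punch k c ≡ punch (suc k) c ⊎ (c ≡ k × punch k c ≡ suc k × punch (suc k) c ≡ k)
punch-neighbours zero    zero    = inj₂ (refl , refl , refl)
punch-neighbours zero    (suc c) = inj₁ refl
punch-neighbours (suc k) zero    = inj₁ refl
punch-neighbours (suc k) (suc c) with punch-neighbours k c
... | inj₁ e               = inj₁ (cong suc e)
... | inj₂ (e₁ , e₂ , e₃)  = inj₂ (cong suc e₁ , cong suc e₂ , cong suc e₃)

sgn : ℕ → ℤ
sgn j = (- 1ℤ) ^ j

minor : ℕ → Matrix → Matrix
minor j A r c = A (suc r) (punch j c)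

det′ : ℕ → Matrix → ℤ
det′ zero    A = 1ℤ
det′ (suc n) A = sumTo (suc n) (λ j → sgn j * (A 0 j * det′ n (minor j A)))

det-cong : ∀ n {A B : Fin n → Fin n → ℤ} → (∀ r c → A r c ≡ B r c) → det n A ≡ det n B
det-cong zero    e = refl
det-cong (suc n) e = sumFin-cong (suc n) λ j →
  cong₂ (λ u v → (- 1ℤ) ^ toℕ j * (u * v)) (e Fin.zero j)
        (det-cong n (λ r c → e (Fin.suc r) (punchIn j c)))

det≡det′ : ∀ n (A : Matrix) → det n (λ r c → A (toℕ r) (toℕ c)) ≡ det′ n A
det≡det′ zero    A = refl
det≡det′ (suc n) A = sumFin-cong (suc n) λ j →
  cong (λ v → (- 1ℤ) ^ toℕ j * (A 0 (toℕ j) * v))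
       (trans (det-cong n (λ r c → cong (A (suc (toℕ r))) (toℕ-punchIn j c)))
              (det≡det′ n (minor (toℕ j) A)))

Agree : ℕ → Matrix → Matrix → Set
Agree n A B = ∀ r c → r < n → c < n → A r c ≡ B r c

AgreeOff : ℕ → ℕ → Matrix → Matrix → Set
AgreeOff n k A B = ∀ r c → r < n → c < n → c ≢ k → A r c ≡ B r c

det′-cong : ∀ n {A B : Matrix} → Agree n A B → det′ n A ≡ det′ n B
det′-cong zero    e = refl
det′-cong (suc n) e = sumTo-cong (suc n) λ j j<n →
  cong₂ (λ u v → sgn j * (u * v)) (e 0 j (s≤s z≤n) j<n)
        (det′-cong n (λ r c r<n c<n → e (suc r) (punch j c) (s≤s r<n) (punch-< j c c<n)))

minor-Agree : ∀ {n k A B} → AgreeOff (suc n) k A B → Agree n (minor k A) (minor k B)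
minor-Agree {k = k} e r c r<n c<n = e (suc r) (punch k c) (s≤s r<n) (punch-< k c c<n) (punch≢ k c)

minor-AgreeOff : ∀ {n k A B} j k′ → punch j k′ ≡ k →
  AgreeOff (suc n) k A B → AgreeOff n k′ (minor j A) (minor j B)
minor-AgreeOff j k′ e agree r c r<n c<n c≢k′ =
  agree (suc r) (punch j c) (s≤s r<n) (punch-< j c c<n)
        (λ e′ → c≢k′ (punch-injective j c k′ (trans e′ (sym e))))

det′-linear : ∀ n k {A B C : Matrix} a b → k < n → AgreeOff n k A B → AgreeOff n k A C →
  (∀ r → r < n → A r k ≡ a * B r k + b * C r k) → det′ n A ≡ a * det′ n B + b * det′ n C
det′-linear (suc n) k {A} {B} {C} a b k<n agreeB agreeC colₖ =
  trans (sumTo-cong (suc n) term) (sumFin-linear (suc n) a b (λ j → T B (toℕ j)) (λ j → T C (toℕ j)))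
  where
  T : Matrix → ℕ → ℤ
  T M j = sgn j * (M 0 j * det′ n (minor j M))

  expand-column : ∀ a b s x y D → s * ((a * x + b * y) * D) ≡ a * (s * (x * D)) + b * (s * (y * D))
  expand-column = solve-∀

  expand-minor : ∀ a b s x P Q → s * (x * (a * P + b * Q)) ≡ a * (s * (x * P)) + b * (s * (x * Q))
  expand-minor = solve-∀

  term : ∀ j → j < suc n → T A j ≡ a * T B j + b * T C j
  term j j<n with j ℕ.≟ k
  ... | yes refl = begin
    sgn j * (A 0 j * det′ n (minor j A))
      ≡⟨ cong₂ (λ u v → sgn j * (u * v)) (colₖ 0 (s≤s z≤n)) (det′-cong n (minor-Agree agreeB)) ⟩
    sgn j * ((a * B 0 j + b * C 0 j) * det′ n (minor j B))
      ≡⟨ expand-column a b (sgn j) (B 0 j) (C 0 j) _ ⟩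
    a * T B j + b * (sgn j * (C 0 j * det′ n (minor j B)))
      ≡⟨ cong (λ v → a * T B j + b * (sgn j * (C 0 j * v))) (det′-cong n (λ r c r<n c<n →
           trans (sym (minor-Agree agreeB r c r<n c<n)) (minor-Agree agreeC r c r<n c<n))) ⟩
    a * T B j + b * T C j ∎
    where open ≡-Reasoning
  ... | no j≢k with punch-surjective n j k j≢k j<n k<n
  ... | k′ , e , k′<n = begin
    sgn j * (A 0 j * det′ n (minor j A))
      ≡⟨ cong (λ v → sgn j * (A 0 j * v)) (det′-linear n k′ a b k′<n
           (minor-AgreeOff j k′ e agreeB) (minor-AgreeOff j k′ e agreeC)
           (λ r r<n → subst (λ z → A (suc r) z ≡ a * B (suc r) z + b * C (suc r) z) (sym e)
                            (colₖ (suc r) (s≤s r<n)))) ⟩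
    sgn j * (A 0 j * (a * det′ n (minor j B) + b * det′ n (minor j C)))
      ≡⟨ expand-minor a b (sgn j) (A 0 j) _ _ ⟩
    a * (sgn j * (A 0 j * det′ n (minor j B))) + b * (sgn j * (A 0 j * det′ n (minor j C)))
      ≡⟨ cong₂ (λ u v → a * (sgn j * (u * det′ n (minor j B))) + b * (sgn j * (v * det′ n (minor j C))))
           (agreeB 0 j (s≤s z≤n) j<n j≢k) (agreeC 0 j (s≤s z≤n) j<n j≢k) ⟩
    a * T B j + b * T C j ∎
    where open ≡-Reasoning

-- A determinant with two equal adjacent columns k and k+1 vanishes: in the
-- expansion the two terms for j = k, k+1 cancel and all others vanish by
-- induction.
det′-adjacent-equal : ∀ n k {A : Matrix} → suc k < n →
  (∀ r → r < n → A r k ≡ A r (suc k)) → det′ n A ≡ 0ℤ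
det′-adjacent-equal (suc n) k {A} sk<n equal = sumTo-cancel (suc n) k T sk<n others neighbours
  where
  T : ℕ → ℤ
  T j = sgn j * (A 0 j * det′ n (minor j A))

  same-minor : Agree n (minor k A) (minor (suc k) A)
  same-minor r c r<n c<n with punch-neighbours k c
  ... | inj₁ e                = cong (A (suc r)) e
  ... | inj₂ (_ , e₁ , e₂)    = trans (cong (A (suc r)) e₁)
                                      (trans (sym (equal (suc r) (s≤s r<n)))
                                             (cong (A (suc r)) (sym e₂)))

  neighbours : T (suc k) ≡ - T k
  neighbours = begin
    - 1ℤ * sgn k * (A 0 (suc k) * det′ n (minor (suc k) A))
      ≡⟨ cong₂ (λ u v → - 1ℤ * sgn k * (u * v)) (sym (equal 0 (s≤s z≤n))) (sym (det′-cong n same-minor)) ⟩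
    - 1ℤ * sgn k * (A 0 k * det′ n (minor k A))
      ≡⟨ negate (sgn k) _ ⟩
    - T k ∎
    where
    open ≡-Reasoning
    negate : ∀ s X → - 1ℤ * s * X ≡ - (s * X)
    negate = solve-∀

  others : ∀ j → j < suc n → j ≢ k → j ≢ suc k → T j ≡ 0ℤ
  others j j<n j≢k j≢sk
    with punch-surjective n j k j≢k j<n (ℕP.<-trans (ℕP.n<1+n k) sk<n)
       | punch-surjective n j (suc k) j≢sk j<n sk<n
  ... | k′ , eₖ , _ | l′ , eₗ , l′<n =
    trans (cong (λ v → sgn j * (A 0 j * v)) (det′-adjacent-equal n k′ sk′<n equal′))
          (trans (cong (sgn j *_) (ℤP.*-zeroʳ (A 0 j))) (ℤP.*-zeroʳ (sgn j)))
    where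
    eₛₖ : punch j (suc k′) ≡ suc k
    eₛₖ = trans (punch-suc j k′ (λ e → j≢sk (trans e (cong suc eₖ)))) (cong suc eₖ)
    sk′<n : suc k′ < n
    sk′<n = subst (_< n) (punch-injective j l′ (suc k′) (trans eₗ (sym eₛₖ))) l′<n
    equal′ : ∀ r → r < n → minor j A r k′ ≡ minor j A r (suc k′)
    equal′ r r<n = trans (cong (A (suc r)) eₖ)
                         (trans (equal (suc r) (s≤s r<n)) (cong (A (suc r)) (sym eₛₖ)))

det′-column-divisible : ∀ n k g {A : Matrix} → k < n → (∀ r → r < n → g ∣ₛ A r k) → g ∣ₛ det′ n A
det′-column-divisible (suc n) k g {A} k<n colₖ = sumFin-divisible (suc n) g (λ j → term (toℕ j) (FinP.toℕ<n j))
  where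
  term : ∀ j → j < suc n → g ∣ₛ sgn j * (A 0 j * det′ n (minor j A))
  term j j<n with j ℕ.≟ k
  ... | yes refl = ∣n⇒∣m*n (sgn j) (∣m⇒∣m*n _ (colₖ 0 (s≤s z≤n)))
  ... | no j≢k with punch-surjective n j k j≢k j<n k<n
  ... | k′ , e , k′<n = ∣n⇒∣m*n (sgn j) (∣n⇒∣m*n (A 0 j) (det′-column-divisible n k′ g k′<n
          (λ r r<n → subst (λ z → g ∣ₛ A (suc r) z) (sym e) (colₖ (suc r) (s≤s r<n)))))

setCol : ℕ → (ℕ → ℤ) → Matrix → Matrix
setCol k v A r c with c ℕ.≟ k
... | yes _ = v r
... | no  _ = A r c

setCol-here : ∀ k v A r → setCol k v A r k ≡ v r
setCol-here k v A r with k ℕ.≟ k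
... | yes _   = refl
... | no  k≢k = ⊥-elim (k≢k refl)

setCol-elsewhere : ∀ k v A r c → c ≢ k → setCol k v A r c ≡ A r c
setCol-elsewhere k v A r c c≢k with c ℕ.≟ k
... | yes c≡k = ⊥-elim (c≢k c≡k)
... | no  _   = refl

Adjacent : ℕ → ℕ → Set
Adjacent k l = l ≡ suc k ⊎ k ≡ suc l

Adjacent⇒≢ : ∀ {k l} → Adjacent k l → l ≢ k
Adjacent⇒≢ (inj₁ refl) = ℕP.1+n≢n
Adjacent⇒≢ (inj₂ refl) = ℕP.1+n≢n ∘′ sym

det′-column-step : ∀ n k l (A : Matrix) a b → k < n → l < n → Adjacent k l →
  det′ n (setCol k (λ r → a * A r k + b * A r l) A) ≡ a * det′ n A
det′-column-step n k l A a b k<n l<n adj = begin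
  det′ n (setCol k (λ r → a * A r k + b * A r l) A)
    ≡⟨ det′-linear n k a b k<n (λ r c _ _ c≢k → setCol-elsewhere k _ A r c c≢k)
         (λ r c _ _ c≢k → trans (setCol-elsewhere k _ A r c c≢k) (sym (setCol-elsewhere k _ A r c c≢k)))
         (λ r _ → trans (setCol-here k _ A r) (cong (λ z → a * A r k + b * z) (sym (setCol-here k _ A r)))) ⟩
  a * det′ n A + b * det′ n C
    ≡⟨ cong (λ z → a * det′ n A + b * z) (C-vanishes adj) ⟩
  a * det′ n A + b * 0ℤ
    ≡⟨ trans (cong (λ z → a * det′ n A + z) (ℤP.*-zeroʳ b)) (ℤP.+-identityʳ _) ⟩
  a * det′ n A ∎
  where
  open ≡-Reasoning
  -- A with column k replaced by its neighbour l has two equal adjacent columns.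
  C : Matrix
  C = setCol k (λ r → A r l) A

  Cₖ≡Cₗ : ∀ r → C r k ≡ C r l
  Cₖ≡Cₗ r = trans (setCol-here k _ A r) (sym (setCol-elsewhere k _ A r l (Adjacent⇒≢ adj)))

  C-vanishes : Adjacent k l → det′ n C ≡ 0ℤ
  C-vanishes (inj₁ refl) = det′-adjacent-equal n k l<n (λ r _ → Cₖ≡Cₗ r)
  C-vanishes (inj₂ refl) = det′-adjacent-equal n l k<n (λ r _ → sym (Cₖ≡Cₗ r))

-- 1 + 2 + ⋯ + t, the total exponent picked up by a sweep of t steps.
triangle : ℕ → ℕ
triangle zero    = zero
triangle (suc t) = suc t ℕ.+ triangle t

-- A Horner sweep of M along the columns p 0, p 1, …, p T (each adjacent to
-- the previous one).  Afterwards column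
-- p T holds Σᵢ M(·, p i)·b^(T-i)·cⁱ while the determinant has only been
-- multiplied by a power of c.
module Sweep (M : Matrix) (p : ℕ → ℕ) (c b : ℤ) where

  sweep : ℕ → Matrix
  sweep zero    = M
  sweep (suc t) = setCol (p (suc t)) (λ r → c ^ suc t * sweep t r (p (suc t)) + b * sweep t r (p t)) (sweep t)

  horner : ℕ → ℕ → ℤ
  horner zero    r = M r (p 0)
  horner (suc t) r = c ^ suc t * M r (p (suc t)) + b * horner t r

  horner-closed : ∀ t r → horner t r ≡ sumTo (suc t) (λ i → M r (p i) * (b ^ (t ∸ i) * c ^ i))
  horner-closed zero    r = sym (trans (ℤP.+-identityʳ _) (ℤP.*-identityʳ (M r (p 0))))
  horner-closed (suc t) r = begin
    c ^ suc t * M r (p (suc t)) + b * horner t r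
      ≡⟨ cong (λ z → c ^ suc t * M r (p (suc t)) + b * z) (horner-closed t r) ⟩
    c ^ suc t * M r (p (suc t)) + b * sumTo (suc t) term
      ≡⟨ cong (λ z → c ^ suc t * M r (p (suc t)) + z) (sym (sumFin-scale (suc t) b (λ i → term (toℕ i)))) ⟩
    c ^ suc t * M r (p (suc t)) + sumTo (suc t) (λ i → b * term i)
      ≡⟨ cong₂ _+_ (last-term (M r (p (suc t))) (c ^ suc t))
           (sumTo-cong (suc t) (λ i i≤t → trans (shift-power (M r (p i)) (b ^ (t ∸ i)) (c ^ i) b)
             (cong (λ e → M r (p i) * (b ^ e * c ^ i)) (sym (ℕP.+-∸-assoc 1 (ℕP.≤-pred i≤t)))))) ⟩
    M r (p (suc t)) * (b ^ 0 * c ^ suc t) + sumTo (suc t) term′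
      ≡⟨ ℤP.+-comm (M r (p (suc t)) * (b ^ 0 * c ^ suc t)) (sumTo (suc t) term′) ⟩
    sumTo (suc t) term′ + M r (p (suc t)) * (b ^ 0 * c ^ suc t)
      ≡⟨ cong (λ e → sumTo (suc t) term′ + M r (p (suc t)) * (b ^ e * c ^ suc t)) (sym (ℕP.n∸n≡0 (suc t))) ⟩
    sumTo (suc t) term′ + term′ (suc t)
      ≡⟨ sym (sumTo-snoc (suc t) term′) ⟩
    sumTo (suc (suc t)) term′ ∎
    where
    open ≡-Reasoning
    term term′ : ℕ → ℤ
    term  i = M r (p i) * (b ^ (t ∸ i) * c ^ i)
    term′ i = M r (p i) * (b ^ (suc t ∸ i) * c ^ i)
    last-term : ∀ m x → x * m ≡ m * (1ℤ * x)
    last-term = solve-∀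
    shift-power : ∀ m x y b → b * (m * (x * y)) ≡ m * ((b * x) * y)
    shift-power = solve-∀

  sweep-untouched : ∀ t r k → (∀ i → i < t → p (suc i) ≢ k) → sweep t r k ≡ M r k
  sweep-untouched zero    r k _     = refl
  sweep-untouched (suc t) r k fresh =
    trans (setCol-elsewhere (p (suc t)) _ (sweep t) r k (fresh t ℕP.≤-refl ∘′ sym))
          (sweep-untouched t r k (λ i i<t → fresh i (ℕP.m<n⇒m<1+n i<t)))

  sweep-front : ∀ T → (∀ i j → i < j → j ≤ T → p i ≢ p j) →
    ∀ t → t ≤ T → ∀ r → sweep t r (p t) ≡ horner t r
  sweep-front T distinct zero    _    r = refl
  sweep-front T distinct (suc t) st≤T r =
    trans (setCol-here (p (suc t)) _ (sweep t) r)
          (cong₂ (λ u v → c ^ suc t * u + b * v)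
                 (sweep-untouched t r (p (suc t)) (λ i i<t → distinct (suc i) (suc t) (s≤s i<t) st≤T))
                 (sweep-front T distinct t (ℕP.<⇒≤ st≤T) r))

  sweep-det : ∀ n T → (∀ i → i ≤ T → p i < n) → (∀ i → i < T → Adjacent (p (suc i)) (p i)) →
    ∀ t → t ≤ T → det′ n (sweep t) ≡ c ^ triangle t * det′ n M
  sweep-det n T p<n adjacent zero    _    = sym (ℤP.*-identityˡ (det′ n M))
  sweep-det n T p<n adjacent (suc t) st≤T = begin
    det′ n (sweep (suc t))
      ≡⟨ det′-column-step n (p (suc t)) (p t) (sweep t) (c ^ suc t) b
           (p<n (suc t) st≤T) (p<n t (ℕP.<⇒≤ st≤T)) (adjacent t st≤T) ⟩
    c ^ suc t * det′ n (sweep t)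
      ≡⟨ cong (c ^ suc t *_) (sweep-det n T p<n adjacent t (ℕP.<⇒≤ st≤T)) ⟩
    c ^ suc t * (c ^ triangle t * det′ n M)
      ≡⟨ sym (ℤP.*-assoc (c ^ suc t) _ _) ⟩
    c ^ suc t * c ^ triangle t * det′ n M
      ≡⟨ cong (_* det′ n M) (sym (ℤP.^-distribˡ-+-* c (suc t) (triangle t))) ⟩
    c ^ triangle (suc t) * det′ n M ∎
    where open ≡-Reasoning

  sweep-divisible : ∀ n T g → (∀ i → i ≤ T → p i < n) → (∀ i → i < T → Adjacent (p (suc i)) (p i)) →
    (∀ i j → i < j → j ≤ T → p i ≢ p j) →
    (∀ r → r < n → g ∣ₛ sumTo (suc T) (λ i → M r (p i) * (b ^ (T ∸ i) * c ^ i))) →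
    g ∣ₛ c ^ triangle T * det′ n M
  sweep-divisible n T g p<n adjacent distinct rows =
    subst (g ∣ₛ_) (sweep-det n T p<n adjacent T ℕP.≤-refl)
      (det′-column-divisible n (p T) g (p<n T ℕP.≤-refl) λ r r<n →
        subst (g ∣ₛ_) (sym (trans (sweep-front T distinct T ℕP.≤-refl r) (horner-closed T r))) (rows r r<n))

coprime-cancel-power : ∀ {X Y G} → Coprime X Y → ∀ b Z →
  G ℕ∣.∣ X ℕ.* Z → G ℕ∣.∣ Y ℕ.^ b ℕ.* Z → G ℕ∣.∣ Z
coprime-cancel-power _ zero Z _ G∣YᵇZ = subst (_ ℕ∣.∣_) (ℕP.*-identityˡ Z) G∣YᵇZ
coprime-cancel-power {X} {Y} {G} coprime (suc b) Z G∣XZ G∣YᵇZ =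
  coprime-cancel-power coprime b Z G∣XZ (coprime-factors coprime
    ( subst (G ℕ∣.∣_) (swap X (Y ℕ.^ b) Z) (ℕ∣.∣n⇒∣m*n (Y ℕ.^ b) G∣XZ)
    , subst (G ℕ∣.∣_) (ℕP.*-assoc Y (Y ℕ.^ b) Z) G∣YᵇZ ))
  where
  swap : ∀ X W Z → W ℕ.* (X ℕ.* Z) ≡ X ℕ.* (W ℕ.* Z)
  swap = ℕSolver.solve-∀

coprime-cancel-powers : ∀ {X Y G} → Coprime X Y → ∀ a b Z →
  G ℕ∣.∣ X ℕ.^ a ℕ.* Z → G ℕ∣.∣ Y ℕ.^ b ℕ.* Z → G ℕ∣.∣ Z
coprime-cancel-powers _ zero b Z G∣XᵃZ _ = subst (_ ℕ∣.∣_) (ℕP.*-identityˡ Z) G∣XᵃZ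
coprime-cancel-powers {X} {Y} {G} coprime (suc a) b Z G∣XᵃZ G∣YᵇZ =
  coprime-cancel-powers coprime a b Z
    (coprime-cancel-power coprime b (X ℕ.^ a ℕ.* Z)
       (subst (G ℕ∣.∣_) (ℕP.*-assoc X (X ℕ.^ a) Z) G∣XᵃZ)
       (subst (G ℕ∣.∣_) (swap (X ℕ.^ a) (Y ℕ.^ b) Z) (ℕ∣.∣n⇒∣m*n (X ℕ.^ a) G∣YᵇZ)))
    G∣YᵇZ
  where
  swap : ∀ X W Z → X ℕ.* (W ℕ.* Z) ≡ W ℕ.* (X ℕ.* Z)
  swap = ℕSolver.solve-∀

abs-^ : ∀ x a → ∣ x ^ a ∣ ≡ ∣ x ∣ ℕ.^ a
abs-^ x zero    = refl
abs-^ x (suc a) = trans (ℤP.abs-* x (x ^ a)) (cong (∣ x ∣ ℕ.*_) (abs-^ x a))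

coprime-cancel : ∀ {x y g : ℤ} a b D → gcd x y ≡ 1ℤ → g ∣ₛ x ^ a * D → g ∣ₛ y ^ b * D → g ∣ₛ D
coprime-cancel {x} {y} {g} a b D gcd≡1 g∣xᵃD g∣yᵇD = Signed.∣ᵤ⇒∣ (coprime-cancel-powers coprime a b ∣ D ∣
    (subst (∣ g ∣ ℕ∣.∣_) (abs-power-product x a) (Signed.∣⇒∣ᵤ g∣xᵃD))
    (subst (∣ g ∣ ℕ∣.∣_) (abs-power-product y b) (Signed.∣⇒∣ᵤ g∣yᵇD)))
  where
  coprime : Coprime ∣ x ∣ ∣ y ∣
  coprime = gcd≡1⇒coprime (ℤP.+-injective gcd≡1)
  abs-power-product : ∀ z e → ∣ z ^ e * D ∣ ≡ ∣ z ∣ ℕ.^ e ℕ.* ∣ D ∣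
  abs-power-product z e = trans (ℤP.abs-* (z ^ e) D) (cong (ℕ._* ∣ D ∣) (abs-^ z e))

rowValue : Matrix → ℤ → ℤ → ℕ → ℕ → ℤ
rowValue M x y m r = sumTo (suc m) (λ j → M r j * (x ^ (m ∸ j) * y ^ j))

-- Sweeping towards the
-- first column gives g ∣ x^N·det M, sweeping towards the last g ∣ y^N·det M.
det′-divisible : ∀ m (M : Matrix) x y g → gcd x y ≡ 1ℤ →
  (∀ r → r < suc m → g ∣ₛ rowValue M x y m r) → g ∣ₛ det′ (suc m) M
det′-divisible m M x y g gcd≡1 rows = coprime-cancel (triangle m) (triangle m) (det′ (suc m) M) gcd≡1
  (SweepLeft.sweep-divisible (suc m) m g (λ i _ → s≤s (ℕP.m∸n≤m m i))
     (λ i i<m → inj₁ (ℕP.+-∸-assoc 1 i<m))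
     (λ i j i<j j≤m → ℕP.<⇒≢ i<j ∘′ ℕP.∸-cancelˡ-≡ (ℕP.<⇒≤ (ℕP.<-≤-trans i<j j≤m)) j≤m)
     reversed-rows)
  (SweepRight.sweep-divisible (suc m) m g (λ i i≤m → s≤s i≤m) (λ i _ → inj₂ refl)
     (λ i j i<j _ → ℕP.<⇒≢ i<j) rows)
  where
  module SweepLeft  = Sweep M (m ∸_) x y
  module SweepRight = Sweep M (λ i → i) y x

  reversed-rows : ∀ r → r < suc m → g ∣ₛ sumTo (suc m) (λ i → M r (m ∸ i) * (y ^ (m ∸ i) * x ^ i))
  reversed-rows r r<m = subst (g ∣ₛ_)
    (trans (sumTo-reverse (suc m) (λ j → M r j * (x ^ (m ∸ j) * y ^ j))) (sumTo-cong (suc m) reindex))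
    (rows r r<m)
    where
    reindex : ∀ i → i < suc m →
      M r (m ∸ i) * (x ^ (m ∸ (m ∸ i)) * y ^ (m ∸ i)) ≡ M r (m ∸ i) * (y ^ (m ∸ i) * x ^ i)
    reindex i i≤m = cong (M r (m ∸ i) *_)
      (trans (cong (λ e → x ^ e * y ^ (m ∸ i)) (ℕP.m∸[m∸n]≡n (ℕP.≤-pred i≤m))) (ℤP.*-comm (x ^ i) _))

sumTo-truncate : ∀ K N (h : ℕ → ℤ) → K ≤ N → (∀ i → K ≤ i → h i ≡ 0ℤ) → sumTo N h ≡ sumTo K h
sumTo-truncate zero    N       h _         z = sumTo-zero N (λ i _ → z i z≤n)
sumTo-truncate (suc K) (suc N) h (s≤s K≤N) z =
  cong (λ s → h 0 + s) (sumTo-truncate K N (λ i → h (suc i)) K≤N (λ i K≤i → z (suc i) (s≤s K≤i)))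

module BandRow (d : ℕ) (a : Form d) where

  coef-beyond : ∀ i → suc d ≤ i → coef d a i ≡ 0ℤ
  coef-beyond i d<i with i ℕ.<? suc d
  ... | yes i<d = ⊥-elim (ℕP.<-irrefl refl (ℕP.<-≤-trans i<d d<i))
  ... | no  _   = refl

  coef-toℕ : ∀ (i : Fin (suc d)) → coef d a (toℕ i) ≡ a i
  coef-toℕ i with toℕ i ℕ.<? suc d
  ... | yes i<d = cong a (FinP.fromℕ<-toℕ i i<d)
  ... | no  i≮d = ⊥-elim (i≮d (FinP.toℕ<n i))

  band-first : ∀ c → band d a 0 c ≡ coef d a c
  band-first c with 0 ℕ.≤? c
  ... | yes _   = refl
  ... | no  0≰c = ⊥-elim (0≰c z≤n)

  band-suc-first : ∀ r → band d a (suc r) 0 ≡ 0ℤ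
  band-suc-first r with suc r ℕ.≤? 0
  ... | no _ = refl

  band-suc : ∀ r c → band d a (suc r) (suc c) ≡ band d a r c
  band-suc r c with r ℕ.≤? c | suc r ℕ.≤? suc c
  ... | yes _   | yes _         = refl
  ... | no  _   | no  _         = refl
  ... | yes r≤c | no  sr≰sc     = ⊥-elim (sr≰sc (s≤s r≤c))
  ... | no  r≰c | yes (s≤s r≤c) = ⊥-elim (r≰c r≤c)

  band-shift : ∀ r N (w : ℕ → ℤ) →
    sumTo N (λ j → band d a r j * w j) ≡ sumTo (N ∸ r) (λ i → coef d a i * w (i ℕ.+ r))
  band-shift zero    N       w = sumTo-cong N (λ i _ → cong₂ _*_ (band-first i) (cong w (sym (ℕP.+-identityʳ i))))
  band-shift (suc r) zero    w = refl
  band-shift (suc r) (suc N) w = begin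
    band d a (suc r) 0 * w 0 + sumTo N (λ j → band d a (suc r) (suc j) * w (suc j))
      ≡⟨ cong₂ _+_ (trans (cong (_* w 0) (band-suc-first r)) (ℤP.*-zeroˡ (w 0)))
                   (sumTo-cong N (λ j _ → cong (_* w (suc j)) (band-suc r j))) ⟩
    0ℤ + sumTo N (λ j → band d a r j * w (suc j))
      ≡⟨ trans (ℤP.+-identityˡ _) (band-shift r N (λ j → w (suc j))) ⟩
    sumTo (N ∸ r) (λ i → coef d a i * w (suc (i ℕ.+ r)))
      ≡⟨ sumTo-cong (N ∸ r) (λ i _ → cong (λ e → coef d a i * w e) (sym (ℕP.+-suc i r))) ⟩
    sumTo (N ∸ r) (λ i → coef d a i * w (i ℕ.+ suc r)) ∎
    where open ≡-Reasoning

band-rowValue : ∀ d₀ (a : Form (suc d₀)) x y (M : Matrix) r s → s ≤ d₀ →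
  (∀ j → M r j ≡ band (suc d₀) a s j) →
  rowValue M x y (d₀ ℕ.+ suc d₀) r ≡ (x ^ (d₀ ∸ s) * y ^ s) * eval (suc d₀) a x y
band-rowValue d₀ a x y M r s s≤d₀ row = begin
  sumTo (d ℕ.+ d) (λ j → M r j * w j)
    ≡⟨ sumTo-cong (d ℕ.+ d) (λ j _ → cong (_* w j) (row j)) ⟩
  sumTo (d ℕ.+ d) (λ j → band d a s j * w j)
    ≡⟨ band-shift s (d ℕ.+ d) w ⟩
  sumTo (d ℕ.+ d ∸ s) (λ i → coef d a i * w (i ℕ.+ s))
    ≡⟨ sumTo-truncate (suc d) (d ℕ.+ d ∸ s) (λ i → coef d a i * w (i ℕ.+ s)) enough-terms
         (λ i d<i → trans (cong (_* w (i ℕ.+ s)) (coef-beyond i d<i)) (ℤP.*-zeroˡ (w (i ℕ.+ s)))) ⟩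
  sumTo (suc d) (λ i → coef d a i * w (i ℕ.+ s))
    ≡⟨ sumFin-cong (suc d) factor ⟩
  sumFin (suc d) (λ i → P * (a i * (x ^ (d ∸ toℕ i) * y ^ toℕ i)))
    ≡⟨ sumFin-scale (suc d) P (λ i → a i * (x ^ (d ∸ toℕ i) * y ^ toℕ i)) ⟩
  P * eval d a x y ∎
  where
  open ≡-Reasoning
  open BandRow (suc d₀) a
  d m : ℕ
  d = suc d₀
  m = d₀ ℕ.+ suc d₀
  w : ℕ → ℤ
  w j = x ^ (m ∸ j) * y ^ j
  P : ℤ
  P = x ^ (d₀ ∸ s) * y ^ s

  enough-terms : suc d ≤ d ℕ.+ d ∸ s
  enough-terms = ℕP.m+n≤o⇒m≤o∸n (suc d)
    (subst (suc d ℕ.+ s ≤_) (cong suc (sym (ℕP.+-suc d₀ d₀))) (ℕP.+-monoʳ-≤ (suc d) s≤d₀))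

  exponent : ∀ i → i ≤ d → m ∸ (i ℕ.+ s) ≡ (d₀ ∸ s) ℕ.+ (d ∸ i)
  exponent i i≤d = trans (cong (_∸ (i ℕ.+ s)) (sym total)) (ℕP.m+n∸n≡m _ (i ℕ.+ s))
    where
    regroup : ∀ A B i s → A ℕ.+ B ℕ.+ (i ℕ.+ s) ≡ (A ℕ.+ s) ℕ.+ (B ℕ.+ i)
    regroup = ℕSolver.solve-∀
    total : (d₀ ∸ s) ℕ.+ (d ∸ i) ℕ.+ (i ℕ.+ s) ≡ m
    total = trans (regroup (d₀ ∸ s) (d ∸ i) i s) (cong₂ ℕ._+_ (ℕP.m∸n+n≡m s≤d₀) (ℕP.m∸n+n≡m i≤d))

  factor : ∀ (i : Fin (suc d)) →
    coef d a (toℕ i) * w (toℕ i ℕ.+ s) ≡ P * (a i * (x ^ (d ∸ toℕ i) * y ^ toℕ i))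
  factor i = begin
    coef d a (toℕ i) * (x ^ (m ∸ (toℕ i ℕ.+ s)) * y ^ (toℕ i ℕ.+ s))
      ≡⟨ cong₂ (λ u e → u * (x ^ e * y ^ (toℕ i ℕ.+ s)))
               (coef-toℕ i) (exponent (toℕ i) (ℕP.≤-pred (FinP.toℕ<n i))) ⟩
    a i * (x ^ ((d₀ ∸ s) ℕ.+ (d ∸ toℕ i)) * y ^ (toℕ i ℕ.+ s))
      ≡⟨ cong₂ (λ u v → a i * (u * v))
               (ℤP.^-distribˡ-+-* x (d₀ ∸ s) (d ∸ toℕ i)) (ℤP.^-distribˡ-+-* y (toℕ i) s) ⟩
    a i * ((x ^ (d₀ ∸ s) * x ^ (d ∸ toℕ i)) * (y ^ toℕ i * y ^ s))
      ≡⟨ rearrange (a i) (x ^ (d₀ ∸ s)) (x ^ (d ∸ toℕ i)) (y ^ toℕ i) (y ^ s) ⟩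
    P * (a i * (x ^ (d ∸ toℕ i) * y ^ toℕ i)) ∎
    where
    rearrange : ∀ c X₁ X₂ Y₁ Y₂ → c * ((X₁ * X₂) * (Y₁ * Y₂)) ≡ (X₁ * Y₂) * (c * (X₂ * Y₁))
    rearrange = solve-∀

sylvesterℕ : (d : ℕ) → Form d → Form d → Matrix
sylvesterℕ d a b r c with r ℕ.<? d
... | yes _ = band d a r c
... | no  _ = band d b (r ∸ d) c

sylvester≡sylvesterℕ : ∀ d a b (r c : Fin (d ℕ.+ d)) → sylvester d a b r c ≡ sylvesterℕ d a b (toℕ r) (toℕ c)
sylvester≡sylvesterℕ d a b r c with toℕ r ℕ.<? d
... | yes _ = refl
... | no  _ = refl

sylvester-top : ∀ d a b r → r < d → ∀ c → sylvesterℕ d a b r c ≡ band d a r c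
sylvester-top d a b r r<d c with r ℕ.<? d
... | yes _   = refl
... | no  r≮d = ⊥-elim (r≮d r<d)

sylvester-bottom : ∀ d a b r → d ≤ r → ∀ c → sylvesterℕ d a b r c ≡ band d b (r ∸ d) c
sylvester-bottom d a b r d≤r c with r ℕ.<? d
... | yes r<d = ⊥-elim (ℕP.≤⇒≯ d≤r r<d)
... | no  _   = refl

Res≡det′ : ∀ d a b → Res d a b ≡ det′ (d ℕ.+ d) (sylvesterℕ d a b)
Res≡det′ d a b =
  trans (det-cong (d ℕ.+ d) (sylvester≡sylvesterℕ d a b)) (det≡det′ (d ℕ.+ d) (sylvesterℕ d a b))

sylvester-rows-divisible : ∀ d₀ (F G : Form (suc d₀)) x y g →
  g ∣ₛ eval (suc d₀) F x y → g ∣ₛ eval (suc d₀) G x y →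
  ∀ r → r < suc (d₀ ℕ.+ suc d₀) → g ∣ₛ rowValue (sylvesterℕ (suc d₀) F G) x y (d₀ ℕ.+ suc d₀) r
sylvester-rows-divisible d₀ F G x y g g∣F g∣G r r<2d with ℕP.<-≤-connex r (suc d₀)
... | inj₁ r<d = subst (g ∣ₛ_)
  (sym (band-rowValue d₀ F x y (sylvesterℕ (suc d₀) F G) r r (ℕP.≤-pred r<d)
                      (sylvester-top (suc d₀) F G r r<d)))
  (∣n⇒∣m*n (x ^ (d₀ ∸ r) * y ^ r) g∣F)
... | inj₂ d≤r = subst (g ∣ₛ_)
  (sym (band-rowValue d₀ G x y (sylvesterℕ (suc d₀) F G) r (r ∸ suc d₀)
                      (ℕP.≤-pred (ℕP.m<n+o⇒m∸n<o r (suc d₀) r<2d))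
                      (sylvester-bottom (suc d₀) F G r d≤r)))
  (∣n⇒∣m*n (x ^ (d₀ ∸ (r ∸ suc d₀)) * y ^ (r ∸ suc d₀)) g∣G)

common-divisor∣Res : ∀ d → d ≥ 1 → (F G : Form d) → (x y g : ℤ) → gcd x y ≡ 1ℤ →
  g ∣ₛ eval d F x y → g ∣ₛ eval d G x y → g ∣ₛ Res d F G
common-divisor∣Res (suc d₀) _ F G x y g gcd≡1 g∣F g∣G =
  subst (g ∣ₛ_) (sym (Res≡det′ (suc d₀) F G))
    (det′-divisible (d₀ ℕ.+ suc d₀) (sylvesterℕ (suc d₀) F G) x y g gcd≡1
       (sylvester-rows-divisible d₀ F G x y g g∣F g∣G))

∣gcd-left : ∀ a b → gcd a b ∣ₛ a
∣gcd-left a b = Signed.∣ᵤ⇒∣ {gcd a b} {a} (gcd[i,j]∣i a b)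

∣gcd-right : ∀ a b → gcd a b ∣ₛ b
∣gcd-right a b = Signed.∣ᵤ⇒∣ {gcd a b} {b} (gcd[i,j]∣j a b)

∣gcd⇒∣ : ∀ {k} a b → k ∣ₛ gcd a b → k ∣ₛ a × k ∣ₛ b
∣gcd⇒∣ a b k∣gcd = Signed.∣-trans k∣gcd (∣gcd-left a b) , Signed.∣-trans k∣gcd (∣gcd-right a b)

∣⇒∣gcd : ∀ {k} a b → k ∣ₛ a → k ∣ₛ b → k ∣ₛ gcd a b
∣⇒∣gcd {k} a b k∣a k∣b =
  Signed.∣ᵤ⇒∣ {k} {gcd a b}
    (gcd-greatest {a} {b} {k} (Signed.∣⇒∣ᵤ {k} {a} k∣a) (Signed.∣⇒∣ᵤ {k} {b} k∣b))

gcd-unique : ∀ a b c e → (∀ k → k ∣ₛ a → k ∣ₛ b → k ∣ₛ c × k ∣ₛ e) →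
  (∀ k → k ∣ₛ c → k ∣ₛ e → k ∣ₛ a × k ∣ₛ b) → gcd a b ≡ gcd c e
gcd-unique a b c e ab⇒ce ce⇒ab = cong +_ (ℕ∣.∣-antisym (gcd∣gcd a b c e ab⇒ce) (gcd∣gcd c e a b ce⇒ab))
  where
  gcd∣gcd : ∀ a b c e → (∀ k → k ∣ₛ a → k ∣ₛ b → k ∣ₛ c × k ∣ₛ e) → gcd a b ∣ gcd c e
  gcd∣gcd a b c e common with common (gcd a b) (∣gcd-left a b) (∣gcd-right a b)
  ... | g∣c , g∣e =
    gcd-greatest {c} {e} {gcd a b} (Signed.∣⇒∣ᵤ {gcd a b} {c} g∣c) (Signed.∣⇒∣ᵤ {gcd a b} {e} g∣e)

congruent-divisible : ∀ {k R} u v → k ∣ₛ R → R ∣ u - v → k ∣ₛ v → k ∣ₛ u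
congruent-divisible {k} {R} u v k∣R R∣u-v k∣v =
  subst (k ∣ₛ_) (split u v)
    (∣m∣n⇒∣m+n {k} {u - v} {v} (Signed.∣-trans k∣R (Signed.∣ᵤ⇒∣ {R} {u - v} R∣u-v)) k∣v)
  where
  split : ∀ u v → (u - v) + v ≡ u
  split = solve-∀

congruent-divisible′ : ∀ {k R} u v → k ∣ₛ R → R ∣ u - v → k ∣ₛ u → k ∣ₛ v
congruent-divisible′ {k} {R} u v k∣R R∣u-v k∣u =
  subst (k ∣ₛ_) (split u v)
    (Signed.∣m∣n⇒∣m-n {k} {u} {u - v} k∣u (Signed.∣-trans k∣R (Signed.∣ᵤ⇒∣ {R} {u - v} R∣u-v)))
  where
  split : ∀ u v → u - (u - v) ≡ v
  split = solve-∀

lemma2p6 : (d : ℕ) → d ≥ 1 → (F G : Form d) → (x y : ℤ) → gcd x y ≡ 1ℤ →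
    (x′ y′ : ℤ) → Res d F G ∣ (x′ - eval d F x y) → Res d F G ∣ (y′ - eval d G x y) →
    gcd (eval d F x y) (eval d G x y) ≡ gcd (gcd x′ y′) (Res d F G)
lemma2p6 d d≥1 F G x y gcd≡1 x′ y′ R∣x′-F R∣y′-G =
  gcd-unique Fxy Gxy (gcd x′ y′) (Res d F G) to-residues from-residues
  where
  Fxy Gxy : ℤ
  Fxy = eval d F x y
  Gxy = eval d G x y

  to-residues : ∀ k → k ∣ₛ eval d F x y → k ∣ₛ eval d G x y → k ∣ₛ gcd x′ y′ × k ∣ₛ Res d F G
  to-residues k k∣F k∣G =
    ∣⇒∣gcd x′ y′ (congruent-divisible x′ Fxy k∣R R∣x′-F k∣F) (congruent-divisible y′ Gxy k∣R R∣y′-G k∣G)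
    , k∣R
    where
    k∣R : k ∣ₛ Res d F G
    k∣R = common-divisor∣Res d d≥1 F G x y k gcd≡1 k∣F k∣G

  from-residues : ∀ k → k ∣ₛ gcd x′ y′ → k ∣ₛ Res d F G → k ∣ₛ eval d F x y × k ∣ₛ eval d G x y
  from-residues k k∣gcd k∣R with ∣gcd⇒∣ x′ y′ k∣gcd
  ... | k∣x′ , k∣y′ =
    congruent-divisible′ x′ Fxy k∣R R∣x′-F k∣x′ , congruent-divisible′ y′ Gxy k∣R R∣y′-G k∣y′
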